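{- Let $G$ be a colored graph with colors $\{0,\dots,d\}$ and $e,e'$ two distinct edges of color 0, and suppose the flip of $e$ and $e'$ turns $G$ into a connected graph $G'$. Then $$C_0(G')=C_0(G)-d+2|I_G(e,e')|.$$ In particular, for $d=3$: (1) if an endpoint of $e$ and an endpoint of $e'$ are joined by exactly one edge (of some color $c\in\{1,2,3\}$), then $C_0(G')\ge C_0(G)-1$; (2) if an endpoint of $e$ and an endpoint of $e'$ are joined by exactly two parallel edges (of colors in $\{1,2,3\}$), then $C_0(G')\ge C_0(G)+1$.
   Context: A colored graph with colors $\{0,\dots,d\}$ is a finite connected bipartite graph (black/white vertices, multiple edges allowed) in which each edge carries a color in $\{0,\dots,d\}$ and each vertex has exactly one incident edge of each color. A bicolored cycle with colors $\{a,b\}$ is a connected component of the subgraph of edges of colors $a,b$; $C_0(G)$ is the number of bicolored cycles with colors $\{0,c\}$, $c=1,\dots,d$. Flip: if $e$ joins $v_1$ to $\bar v_1$ and $e'$ joins $v_2$ to $\bar v_2$ (with $v_1,v_2$ white and $\bar v_1,\bar v_2$ black), the flip removes $e,e'$ and adds two edges of color 0, one between $v_1$ and $\bar v_2$ and one between $v_2$ and $\bar v_1$. $I_G(e,e')\subset\{1,\dots,d\}$ is the set of colors $c$ such that the same bicolored cycle of colors $\{0,c\}$ passes through both $e$ and $e'$. -}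

module Defs where

open import Data.Nat using (ℕ; suc; _+_)
open import Data.Fin using (Fin; zero; suc)
open import Data.Fin.Permutation using (Permutation′; _⟨$⟩ʳ_; _∘ₚ_; transpose)
open import Data.Sum using (_⊎_; inj₁; inj₂)
open import Data.Product using (Σ; ∃; _×_)
open import Data.Unit using (⊤)
open import Data.List using (tabulate)
open import Data.Nat.ListAction using (sum)
open import Relation.Binary.PropositionalEquality using (_≡_; _≢_)
open import Relation.Binary.Construct.Closure.ReflexiveTransitive using (Star)

-- Since every vertex has exactly one
-- incident edge of each color, the edges of color c form a perfect matching
-- between white and black vertices; hence there are n white and n black
-- vertices, both labelled by Fin n, and the edges of color c are encoded by a
-- bijection σ c : white i is joined by its color-c edge to black (σ c i).
-- The color-c edge is identified with its white endpoint.  Multiple edges are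
-- allowed (σ a i ≡ σ b i for a ≢ b).
record ColoredGraph (d : ℕ) : Set where
  field
    n : ℕ
    σ : Fin (suc d) → Permutation′ n

open ColoredGraph public

-- vertices: inj₁ i = white vertex i, inj₂ j = black vertex j
Vertex : ∀ {d} → ColoredGraph d → Set
Vertex G = Fin (n G) ⊎ Fin (n G)

nb : ∀ {d} (G : ColoredGraph d) → Fin (suc d) → Fin (n G) → Fin (n G)
nb G c i = σ G c ⟨$⟩ʳ i

data Step {d} (G : ColoredGraph d) (S : Fin (suc d) → Set) : Vertex G → Vertex G → Set where
  wb : ∀ c i → S c → Step G S (inj₁ i) (inj₂ (nb G c i))
  bw : ∀ c i → S c → Step G S (inj₂ (nb G c i)) (inj₁ i)

Reach : ∀ {d} (G : ColoredGraph d) (S : Fin (suc d) → Set) → Vertex G → Vertex G → Set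
Reach G S = Star (Step G S)

AllColors : ∀ {d} → Fin (suc d) → Set
AllColors _ = ⊤

Connected : ∀ {d} → ColoredGraph d → Set
Connected G = ∀ u w → Reach G AllColors u w

-- the color set {0, c} for c ∈ {1,…,d}; color c ∈ {1,…,d} is written suc c with c : Fin d
Bic : ∀ {d} → Fin d → Fin (suc d) → Set
Bic c a = (a ≡ zero) ⊎ (a ≡ suc c)

-- the subgraph with colors in S has exactly k connected components:
-- a surjective labelling of vertices by Fin k whose fibres are exactly the
-- reachability classes
NumComponents : ∀ {d} (G : ColoredGraph d) (S : Fin (suc d) → Set) → ℕ → Set
NumComponents G S k =
  Σ (Vertex G → Fin k) λ f →
    (∀ j → ∃ λ v → f v ≡ j) ×
    (∀ u w → f u ≡ f w → Reach G S u w) ×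
    (∀ u w → Reach G S u w → f u ≡ f w)

-- C₀(G) = m : m is the total number of bicolored cycles with colors {0,c}, c = 1..d
C₀ : ∀ {d} → ColoredGraph d → ℕ → Set
C₀ {d} G m =
  Σ (Fin d → ℕ) λ k → (∀ c → NumComponents G (Bic c) (k c)) × (sum (tabulate k) ≡ m)

-- the flip of the color-0 edges at white vertices v₁ and v₂:
-- new color-0 edges v₁ — σ₀ v₂ and v₂ — σ₀ v₁, all other edges unchanged
flipG : ∀ {d} (G : ColoredGraph d) → Fin (n G) → Fin (n G) → ColoredGraph d
flipG {d} G v₁ v₂ = record { n = n G ; σ = σ' }
  where
  σ' : Fin (suc d) → Permutation′ (n G)
  σ' zero    = transpose v₁ v₂ ∘ₚ σ G zero
  σ' (suc c) = σ G (suc c)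

-- c ∈ I_G(e,e'): the same {0,c} bicolored cycle passes through the color-0
-- edges at white vertices v₁ and v₂ (i.e. contains both of their white endpoints)
SameCycle : ∀ {d} (G : ColoredGraph d) → Fin d → Fin (n G) → Fin (n G) → Set
SameCycle G c v₁ v₂ = Reach G (Bic c) (inj₁ v₁) (inj₁ v₂)

JoinedOnce : ∀ {d} (G : ColoredGraph d) → Fin (n G) → Fin (n G) → Set
JoinedOnce {d} G x y =
  ∃ λ (c : Fin (suc d)) → (nb G c x ≡ y) × (∀ c' → nb G c' x ≡ y → c' ≡ c)

JoinedTwice : ∀ {d} (G : ColoredGraph d) → Fin (n G) → Fin (n G) → Set
JoinedTwice {d} G x y =
  ∃ λ (c : Fin (suc d)) → ∃ λ (c' : Fin (suc d)) →
    (c ≢ c') × (nb G c x ≡ y) × (nb G c' x ≡ y) ×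
    (∀ c'' → nb G c'' x ≡ y → (c'' ≡ c) ⊎ (c'' ≡ c'))

module Submission where

-- For a colour 1 + c, "follow the colour-0 edge, then the colour-(1+c) edge back"
-- is a permutation τ of the white vertices whose orbits are the {0,1+c}-cycles
-- (module Cycles).  The flip replaces τ by τ ∘ (v₁ v₂), and composing a
-- permutation with a transposition (a b) splits the common orbit of a and b in
-- two, or merges their two orbits into one (module Transposition, built on the
-- orbit theory of module Orbits).  So for each colour either v₁, v₂ lie on one
-- cycle, which the flip splits, or the flip joins their two cycles (Flip.toggles).
-- The purely combinatorial splitCount (via MergeCount) turns this into "one
-- component more / one less" for the labellings of NumComponents
-- (Flip.Edges.countChange); summing over the colours gives flipFormula, and for
-- d = 3 the two bounds follow since each colour of an edge joining v₁ to the
-- colour-0 partner of v₂ (or vice versa) lies in I.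

open import Defs
open import Data.Nat using (ℕ; zero; suc; _+_; _*_; _≤_; _<_; z≤n; s≤s)
open import Data.Nat.Properties
  using (n<1+n; ≤-refl; ≤-trans; <⇒≤; ≤-antisym; m<1+n⇒m<n∨m≡n; m≤n⇒m<n∨m≡n; m≤n⇒∃[o]m+o≡n;
         +-suc; +-comm; +-assoc; *-suc; +-monoʳ-≤; *-monoʳ-≤; +-cancelʳ-≤)
open import Data.Nat.Tactic.RingSolver using (solve-∀)
open import Data.Fin using (Fin; toℕ) renaming (zero to fzero; suc to fsuc)
open import Data.Fin.Properties using (_≟_; pigeonhole; injective⇒≤; suc-injective)
open import Data.Fin.Permutation using (Permutation′; _⟨$⟩ʳ_; _⟨$⟩ˡ_; inverseˡ; inverseʳ)
import Data.Fin.Permutation.Components as PC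
open import Data.Fin.Subset using (Subset; _∈_; _∉_; ∣_∣; inside; outside)
open import Data.Fin.Subset.Properties
  using (p⊆q⇒∣p∣≤∣q∣; ∣⁅x⁆∣≡1; x∈⁅y⁆⇒x≡y; x∈p∧x≢y⇒x∈p-y; x∈p⇒∣p-x∣<∣p∣)
open import Data.Vec using ([]; _∷_; here; there)
open import Data.List using (tabulate)
open import Data.Nat.ListAction using (sum)
open import Data.Bool using (if_then_else_)
open import Data.Product using (Σ; ∃; _×_; _,_; proj₁; proj₂; map₂)
open import Data.Sum using (_⊎_; inj₁; inj₂; [_,_]; [_,_]′) renaming (map to map-⊎)
open import Data.Empty using (⊥-elim)
open import Function using (_∘_)
open import Relation.Nullary using (¬_; Dec; yes; no; does)
open import Relation.Nullary.Decidable using (dec-true; dec-false; _⊎-dec_)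
open import Relation.Binary.PropositionalEquality
  using (_≡_; _≢_; refl; sym; trans; cong; subst; module ≡-Reasoning)
open import Relation.Binary.Construct.Closure.ReflexiveTransitive
  using (Star; ε; _◅_; _◅◅_; fold; reverse)

leastWitness : {P : ℕ → Set} → (∀ j → Dec (P j)) → ∀ m → P m →
               ∃ λ p → P p × (∀ j → j < p → ¬ P j)
leastWitness {P} P? m Pm =
  [ (λ none → ⊥-elim (none m ≤-refl Pm)) , (λ least → least) ] (searchBelow (suc m))
  where
  searchBelow : ∀ b → (∀ j → j < b → ¬ P j) ⊎ ∃ λ p → P p × (∀ j → j < p → ¬ P j)
  searchBelow zero = inj₁ (λ _ ())
  searchBelow (suc b) with searchBelow b
  ... | inj₂ least = inj₂ least
  ... | inj₁ none with P? b
  ...   | yes Pb = inj₂ (b , Pb , none)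
  ...   | no ¬Pb = inj₁ λ j j<1+b →
          [ none j , (λ { refl → ¬Pb }) ] (m<1+n⇒m<n∨m≡n j<1+b)

perm-injective : ∀ {m} (π : Permutation′ m) {i j} → π ⟨$⟩ʳ i ≡ π ⟨$⟩ʳ j → i ≡ j
perm-injective π e = trans (sym (inverseˡ π)) (trans (cong (π ⟨$⟩ˡ_) e) (inverseˡ π))

permˡ-injective : ∀ {m} (π : Permutation′ m) {i j} → π ⟨$⟩ˡ i ≡ π ⟨$⟩ˡ j → i ≡ j
permˡ-injective π e = trans (sym (inverseʳ π)) (trans (cong (π ⟨$⟩ʳ_) e) (inverseʳ π))

module Orbits {n : ℕ} (τ : Fin n → Fin n) where

  iter : ℕ → Fin n → Fin n
  iter zero    x = x
  iter (suc k) x = τ (iter k x)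

  iter-+ : ∀ k j x → iter (k + j) x ≡ iter k (iter j x)
  iter-+ zero    j x = refl
  iter-+ (suc k) j x = cong τ (iter-+ k j x)

  Orb : Fin n → Fin n → Set
  Orb x y = ∃ λ k → iter k x ≡ y

  Orb-trans : ∀ {x y z} → Orb x y → Orb y z → Orb x z
  Orb-trans {x} (k , refl) (j , refl) = j + k , iter-+ j k x

  withinCycle : ∀ {x p} → iter (suc p) x ≡ x → ∀ {y} → Orb x y → ∃ λ j → j ≤ p × iter j x ≡ y
  withinCycle {x} {p} cycle (k , refl) = go k
    where
    go : ∀ k → ∃ λ j → j ≤ p × iter j x ≡ iter k x
    go zero = 0 , z≤n , refl
    go (suc k) with go k
    ... | j , j≤p , e with m≤n⇒m<n∨m≡n j≤p
    ...   | inj₁ j<p  = suc j , j<p , cong τ e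
    ...   | inj₂ refl = 0 , z≤n , trans (sym cycle) (cong τ e)

  -- for injective τ every point is periodic, so orbits are symmetric
  module _ (τ-injective : ∀ {x y} → τ x ≡ τ y → x ≡ y) where

    iter-injective : ∀ k {x y} → iter k x ≡ iter k y → x ≡ y
    iter-injective zero    e = e
    iter-injective (suc k) e = iter-injective k (τ-injective e)

    -- two of the first n + 1 iterates coincide (pigeonhole); cancel the earlier one
    periodic : ∀ x → ∃ λ N → iter (suc N) x ≡ x
    periodic x with pigeonhole (n<1+n n) (λ (i : Fin (suc n)) → iter (toℕ i) x)
    ... | i , j , i<j , e with m≤n⇒∃[o]m+o≡n i<j
    ...   | o , i+1+o≡j = o , iter-injective (toℕ i) (begin
            iter (toℕ i) (iter (suc o) x)  ≡⟨ sym (iter-+ (toℕ i) (suc o) x) ⟩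
            iter (toℕ i + suc o) x         ≡⟨ cong (λ t → iter t x) (trans (+-suc (toℕ i) o) i+1+o≡j) ⟩
            iter (toℕ j) x                 ≡⟨ sym e ⟩
            iter (toℕ i) x                 ∎)
      where open ≡-Reasoning

    iter-period : ∀ {x N} → iter (suc N) x ≡ x → ∀ r → iter (r * suc N) x ≡ x
    iter-period         cycle zero    = refl
    iter-period {x} {N} cycle (suc r) =
      trans (iter-+ (suc N) (r * suc N) x) (trans (cong (iter (suc N)) (iter-period cycle r)) cycle)

    -- from y = τᵏ x, a further k · N steps complete k turns of the cycle of x
    Orb-sym : ∀ {x y} → Orb x y → Orb y x
    Orb-sym {x} (k , refl) with periodic x
    ... | N , cycle = k * N , (begin
          iter (k * N) (iter k x)  ≡⟨ sym (iter-+ (k * N) k x) ⟩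
          iter (k * N + k) x       ≡⟨ cong (λ t → iter t x) (trans (+-comm (k * N) k) (sym (*-suc k N))) ⟩
          iter (k * suc N) x       ≡⟨ iter-period cycle k ⟩
          x                        ∎)
      where open ≡-Reasoning

module Swap {n : ℕ} {a b : Fin n} (a≢b : a ≢ b) where

  swap : Fin n → Fin n
  swap = PC.transpose a b

  swap-a : swap a ≡ b
  swap-a rewrite dec-true (a ≟ a) refl = refl

  swap-b : swap b ≡ a
  swap-b rewrite dec-false (b ≟ a) (a≢b ∘ sym) | dec-true (b ≟ b) refl = refl

  swap-fixed : ∀ {i} → i ≢ a → i ≢ b → swap i ≡ i
  swap-fixed {i} i≢a i≢b rewrite dec-false (i ≟ a) i≢a | dec-false (i ≟ b) i≢b = refl

  swap-injective : ∀ {i j} → swap i ≡ swap j → i ≡ j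
  swap-injective e =
    trans (sym (PC.transpose-inverse b a))
          (trans (cong (PC.transpose b a) e) (PC.transpose-inverse b a))

  swap-cases : ∀ i → (i ≡ a × swap i ≡ b) ⊎ (i ≡ b × swap i ≡ a) ⊎ swap i ≡ i
  swap-cases i = classify (i ≟ a) (i ≟ b)
    where
    classify : Dec (i ≡ a) → Dec (i ≡ b) →
               (i ≡ a × swap i ≡ b) ⊎ (i ≡ b × swap i ≡ a) ⊎ swap i ≡ i
    classify (yes i≡a) _         = inj₁ (i≡a , trans (cong swap i≡a) swap-a)
    classify (no _)    (yes i≡b) = inj₂ (inj₁ (i≡b , trans (cong swap i≡b) swap-b))
    classify (no i≢a)  (no i≢b)  = inj₂ (inj₂ (swap-fixed i≢a i≢b))

module Transposition {n : ℕ} (τ : Fin n → Fin n) (τ-injective : ∀ {x y} → τ x ≡ τ y → x ≡ y)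
                     {a b : Fin n} (a≢b : a ≢ b) where

  open Swap a≢b

  τ' : Fin n → Fin n
  τ' x = τ (swap x)

  τ'-injective : ∀ {x y} → τ' x ≡ τ' y → x ≡ y
  τ'-injective = swap-injective ∘ τ-injective

  open Orbits τ
  module O' = Orbits τ'

  HitsAB : ℕ → Set
  HitsAB j = iter (suc j) a ≡ a ⊎ iter (suc j) a ≡ b

  hitsAB? : ∀ j → Dec (HitsAB j)
  hitsAB? j = (iter (suc j) a ≟ a) ⊎-dec (iter (suc j) a ≟ b)

  module FirstHit {p : ℕ} (first : ∀ j → j < p → ¬ HitsAB j) where

    -- until then, the τ'-orbit of b follows the τ-orbit of a, since τ' = τ off {a, b}
    shadow : ∀ j → j ≤ p → O'.iter (suc j) b ≡ iter (suc j) a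
    shadow zero    _    = cong τ swap-b
    shadow (suc j) 1+j≤p = begin
      τ' (O'.iter (suc j) b)    ≡⟨ cong τ' (shadow j (<⇒≤ 1+j≤p)) ⟩
      τ (swap (iter (suc j) a)) ≡⟨ cong τ (swap-fixed (first j 1+j≤p ∘ inj₁) (first j 1+j≤p ∘ inj₂)) ⟩
      τ (iter (suc j) a)        ∎
      where open ≡-Reasoning

    returnsToA : iter (suc p) a ≡ a → ¬ Orb a b × O'.Orb a b
    returnsToA cycle = missesB , O'.Orb-sym τ'-injective (suc p , trans (shadow p ≤-refl) cycle)
      where
      missesB : ¬ Orb a b
      missesB a→b with withinCycle cycle a→b
      ... | zero  , _   , a≡b = a≢b a≡b
      ... | suc j , j<p , e   = first j j<p (inj₂ e)

    reachesB : iter (suc p) a ≡ b → Orb a b × ¬ O'.Orb a b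
    reachesB hit = (suc p , hit) , missesA
      where
      missesA : ¬ O'.Orb a b
      missesA a→b with O'.withinCycle (trans (shadow p ≤-refl) hit) (O'.Orb-sym τ'-injective a→b)
      ... | zero  , _   , b≡a = a≢b (sym b≡a)
      ... | suc j , j<p , e   = first j j<p (inj₁ (trans (sym (shadow j (<⇒≤ j<p))) e))

  -- a is periodic, so its τ-orbit hits {a, b}; decide by the first hit
  splitsOrJoins : (Orb a b × ¬ O'.Orb a b) ⊎ (¬ Orb a b × O'.Orb a b)
  splitsOrJoins with periodic τ-injective a
  ... | N , cycle with leastWitness hitsAB? N (inj₁ cycle)
  ...   | p , inj₁ hitA , first = inj₂ (FirstHit.returnsToA first hitA)
  ...   | p , inj₂ hitB , first = inj₁ (FirstHit.reachesB first hitB)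

-- The ordered pair (w , z) is the unordered pair {a , b}.
Joins : ∀ {A : Set} → A → A → A → A → Set
Joins a b w z = (w ≡ a × z ≡ b) ⊎ (w ≡ b × z ≡ a)

Joins-reverse : ∀ {A : Set} {a b w z : A} → Joins a b w z → Joins a b z w
Joins-reverse (inj₁ (w≡a , z≡b)) = inj₂ (z≡b , w≡a)
Joins-reverse (inj₂ (w≡b , z≡a)) = inj₁ (z≡a , w≡b)

Joins-swap : ∀ {A : Set} {a b w z : A} → Joins a b w z → Joins b a w z
Joins-swap (inj₁ p) = inj₂ p
Joins-swap (inj₂ p) = inj₁ p

Joins-map : ∀ {A B : Set} (f : A → B) {a b w z : A} {α β : B} →
            f a ≡ α → f b ≡ β → Joins a b w z → Joins α β (f w) (f z)
Joins-map f fa fb (inj₁ (refl , refl)) = inj₁ (fa , fb)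
Joins-map f fa fb (inj₂ (refl , refl)) = inj₂ (fb , fa)

Joins-identified : ∀ {A B : Set} (f : A → B) {a b w z : A} → f a ≡ f b → Joins a b w z → f w ≡ f z
Joins-identified f fa≡fb (inj₁ (refl , refl)) = fa≡fb
Joins-identified f fa≡fb (inj₂ (refl , refl)) = sym fa≡fb

-- u and w become equal once the two values X and Y are merged
Merged : ∀ {A : Set} → A → A → A → A → Set
Merged X Y u w = u ≡ w ⊎ Joins X Y u w

Merged-trans : ∀ {A : Set} {X Y u v w : A} →
               Merged X Y u v → Merged X Y v w → Merged X Y u w
Merged-trans (inj₁ refl) m = m
Merged-trans m (inj₁ refl) = m
Merged-trans (inj₂ (inj₁ (refl , refl))) (inj₂ (inj₁ (refl , refl))) = inj₂ (inj₁ (refl , refl))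
Merged-trans (inj₂ (inj₁ (refl , refl))) (inj₂ (inj₂ (refl , refl))) = inj₁ refl
Merged-trans (inj₂ (inj₂ (refl , refl))) (inj₂ (inj₁ (refl , refl))) = inj₁ refl
Merged-trans (inj₂ (inj₂ (refl , refl))) (inj₂ (inj₂ (refl , refl))) = inj₂ (inj₂ (refl , refl))

-- f labels the classes of the relation R bijectively by Fin k; NumComponents G S k
-- is the instance R = Reach G S
Labelling : ∀ {V : Set} → (V → V → Set) → ℕ → Set
Labelling {V} R k =
  Σ (V → Fin k) λ f →
    (∀ j → ∃ λ v → f v ≡ j) × (∀ u w → f u ≡ f w → R u w) × (∀ u w → R u w → f u ≡ f w)

-- The proof gives injections Fin k ↪ Fin (1 + k') and Fin (1 + k') ↪ Fin k.
module MergeCount {V : Set} {k k' : ℕ} (f : V → Fin k) (f' : V → Fin k')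
  (f-onto : ∀ j → ∃ λ v → f v ≡ j) (f'-onto : ∀ j → ∃ λ v → f' v ≡ j)
  {x y : V} (fx≢fy : f x ≢ f y) (f'x≡f'y : f' x ≡ f' y)
  (coarser : ∀ {u w} → f u ≡ f w → f' u ≡ f' w)
  (onlyMerge : ∀ {u w} → f' u ≡ f' w → Merged (f x) (f y) (f u) (f w)) where

  rep : Fin k → V
  rep = proj₁ ∘ f-onto

  rep' : Fin k' → V
  rep' = proj₁ ∘ f'-onto

  down : (ℓ : Fin k) → Dec (ℓ ≡ f y) → Fin (suc k')
  down ℓ (yes _) = fzero
  down ℓ (no _)  = fsuc (f' (rep ℓ))

  down-injective : ∀ ℓ m (dℓ : Dec (ℓ ≡ f y)) (dm : Dec (m ≡ f y)) →
                   down ℓ dℓ ≡ down m dm → ℓ ≡ m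
  down-injective ℓ m (yes ℓ≡fy) (yes m≡fy) _ = trans ℓ≡fy (sym m≡fy)
  down-injective ℓ m (yes _)    (no _)     ()
  down-injective ℓ m (no _)     (yes _)    ()
  down-injective ℓ m (no ℓ≢fy)  (no m≢fy)  e = reconcile (onlyMerge (suc-injective e))
    where
    reconcile : Merged (f x) (f y) (f (rep ℓ)) (f (rep m)) → ℓ ≡ m
    reconcile (inj₁ same)            = trans (sym (proj₂ (f-onto ℓ))) (trans same (proj₂ (f-onto m)))
    reconcile (inj₂ (inj₁ (_ , m≡fy))) = ⊥-elim (m≢fy (trans (sym (proj₂ (f-onto m))) m≡fy))
    reconcile (inj₂ (inj₂ (ℓ≡fy , _))) = ⊥-elim (ℓ≢fy (trans (sym (proj₂ (f-onto ℓ))) ℓ≡fy))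

  relabel : (v : V) → Dec (f v ≡ f y) → Fin k
  relabel v (yes _) = f x
  relabel v (no _)  = f v

  relabel≢fy : ∀ v (dv : Dec (f v ≡ f y)) → relabel v dv ≢ f y
  relabel≢fy v (yes _)    = fx≢fy
  relabel≢fy v (no fv≢fy) = fv≢fy

  -- equal relabels force equal f'-labels, because f' already identifies f x and f y
  relabel-reflects : ∀ v w (dv : Dec (f v ≡ f y)) (dw : Dec (f w ≡ f y)) →
                     relabel v dv ≡ relabel w dw → f' v ≡ f' w
  relabel-reflects v w (yes fv≡fy) (yes fw≡fy) _ = coarser (trans fv≡fy (sym fw≡fy))
  relabel-reflects v w (yes fv≡fy) (no _)      e =
    trans (coarser fv≡fy) (trans (sym f'x≡f'y) (coarser e))
  relabel-reflects v w (no _)      (yes fw≡fy) e =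
    trans (coarser e) (trans f'x≡f'y (sym (coarser fw≡fy)))
  relabel-reflects v w (no _)      (no _)      e = coarser e

  up : Fin (suc k') → Fin k
  up fzero    = f y
  up (fsuc j) = relabel (rep' j) (f (rep' j) ≟ f y)

  up-injective : ∀ {i j} → up i ≡ up j → i ≡ j
  up-injective {fzero}  {fzero}  _ = refl
  up-injective {fzero}  {fsuc j} e = ⊥-elim (relabel≢fy (rep' j) (f (rep' j) ≟ f y) (sym e))
  up-injective {fsuc i} {fzero}  e = ⊥-elim (relabel≢fy (rep' i) (f (rep' i) ≟ f y) e)
  up-injective {fsuc i} {fsuc j} e = cong fsuc (begin
    i             ≡⟨ sym (proj₂ (f'-onto i)) ⟩
    f' (rep' i)   ≡⟨ relabel-reflects _ _ (f (rep' i) ≟ f y) (f (rep' j) ≟ f y) e ⟩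
    f' (rep' j)   ≡⟨ proj₂ (f'-onto j) ⟩
    j             ∎)
    where open ≡-Reasoning

  count : k ≡ suc k'
  count = ≤-antisym (injective⇒≤ {f = λ ℓ → down ℓ (ℓ ≟ f y)} (down-injective _ _ _ _))
                    (injective⇒≤ {f = up} up-injective)

-- Two edge relations St, St' on the same vertices that differ only in two edges:
-- St has x — p and y — q where St' has x — q and y — p.  If x and y are connected
-- by St but not by St', then the St'-classes are the St-classes with the class of
-- x and y split in two, so St' has one class more.
splitCount : ∀ {V : Set} {St St' : V → V → Set} {x y p q : V} {k k' : ℕ} →
  (∀ {w z} → St w z → St' w z ⊎ Joins x p w z ⊎ Joins y q w z) →
  (∀ {w z} → St' w z → St w z ⊎ Joins x q w z ⊎ Joins y p w z) →
  St x p → St y q → St' x q → St' y p →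
  Star St x y → ¬ Star St' x y →
  Labelling (Star St) k → Labelling (Star St') k' → k' ≡ suc k
splitCount {St = St} {St'} {x} {y} old new xp yq xq' yp' xy ¬xy'
           (f , f-onto , f-sound , f-complete) (f' , f'-onto , f'-sound , f'-complete) =
  MergeCount.count f' f f'-onto f-onto (¬xy' ∘ f'-sound x y) (f-complete x y xy) coarser onlyMerge
  where
  fx≡fy : f x ≡ f y
  fx≡fy = f-complete x y xy

  -- every St'-edge stays inside an St-class (the new edges join the class of x and y)
  new-edge : ∀ {w z} → St' w z → f w ≡ f z
  new-edge s with new s
  ... | inj₁ t         = f-complete _ _ (t ◅ ε)
  ... | inj₂ (inj₁ xq) = Joins-identified f (trans fx≡fy (f-complete _ _ (yq ◅ ε))) xq
  ... | inj₂ (inj₂ yp) = Joins-identified f (trans (sym fx≡fy) (f-complete _ _ (xp ◅ ε))) yp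

  old-edge : ∀ {w z} → St w z → Merged (f' x) (f' y) (f' w) (f' z)
  old-edge s with old s
  ... | inj₁ t         = inj₁ (f'-complete _ _ (t ◅ ε))
  ... | inj₂ (inj₁ xp) = inj₂ (Joins-map f' refl (sym (f'-complete _ _ (yp' ◅ ε))) xp)
  ... | inj₂ (inj₂ yq) =
    inj₂ (Joins-swap (Joins-map f' refl (sym (f'-complete _ _ (xq' ◅ ε))) yq))

  coarser : ∀ {u w} → f' u ≡ f' w → f u ≡ f w
  coarser {u} {w} e = fold (λ u w → f u ≡ f w) (λ s → trans (new-edge s)) refl (f'-sound u w e)

  onlyMerge : ∀ {u w} → f u ≡ f w → Merged (f' x) (f' y) (f' u) (f' w)
  onlyMerge {u} {w} e =
    fold (λ u w → Merged (f' x) (f' y) (f' u) (f' w)) (λ s → Merged-trans (old-edge s)) (inj₁ refl)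
         (f-sound u w e)

Step-reverse : ∀ {d} {G : ColoredGraph d} {S : Fin (suc d) → Set} {u w : Vertex G} →
               Step G S u w → Step G S w u
Step-reverse (wb c i s) = bw c i s
Step-reverse (bw c i s) = wb c i s

SameCycle-sym : ∀ {d} {G : ColoredGraph d} {c : Fin d} {u w : Fin (n G)} →
                SameCycle G c u w → SameCycle G c w u
SameCycle-sym = reverse Step-reverse

-- For a colour 1 + c, the map τ "follow the colour-0 edge, then the colour-(1+c)
-- edge back" permutes the white vertices, and its orbits are the white vertices
-- of the {0,1+c}-bicoloured cycles.
module Cycles {d : ℕ} (G : ColoredGraph d) (c : Fin d) where

  τ : Fin (n G) → Fin (n G)
  τ i = σ G (fsuc c) ⟨$⟩ˡ nb G fzero i

  τ-injective : ∀ {i j} → τ i ≡ τ j → i ≡ j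
  τ-injective = perm-injective (σ G fzero) ∘ permˡ-injective (σ G (fsuc c))

  open Orbits τ

  τ-path : ∀ i → SameCycle G c i (τ i)
  τ-path i = wb fzero i (inj₁ refl)
           ◅ subst (λ β → Step G (Bic c) (inj₂ β) (inj₁ (τ i))) (inverseʳ (σ G (fsuc c)))
                   (bw (fsuc c) (τ i) (inj₂ refl))
           ◅ ε

  orbit⇒sameCycle : ∀ {x y} → Orb x y → SameCycle G c x y
  orbit⇒sameCycle {x} (k , refl) = go k
    where
    go : ∀ k → SameCycle G c x (iter k x)
    go zero    = ε
    go (suc k) = go k ◅◅ τ-path (iter k x)

  OnCycleOf : Fin (n G) → Vertex G → Set
  OnCycleOf x (inj₁ y) = Orb x y
  OnCycleOf x (inj₂ β) = ∃ λ y → Orb x y × nb G fzero y ≡ β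

  OnCycleOf-step : ∀ {x u w} → OnCycleOf x u → Step G (Bic c) u w → OnCycleOf x w
  OnCycleOf-step x→i (wb .fzero i (inj₁ refl)) = i , x→i , refl
  OnCycleOf-step x→i (wb .(fsuc c) i (inj₂ refl)) =
    y , Orb-trans x→i (Orb-sym τ-injective (1 , τy≡i)) , inverseʳ (σ G fzero)
    where
    y : Fin (n G)
    y = σ G fzero ⟨$⟩ˡ (σ G (fsuc c) ⟨$⟩ʳ i)
    τy≡i : τ y ≡ i
    τy≡i = trans (cong (σ G (fsuc c) ⟨$⟩ˡ_) (inverseʳ (σ G fzero))) (inverseˡ (σ G (fsuc c)))
  OnCycleOf-step (y , x→y , e) (bw .fzero i (inj₁ refl)) =
    subst (Orb _) (perm-injective (σ G fzero) e) x→y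
  OnCycleOf-step (y , x→y , e) (bw .(fsuc c) i (inj₂ refl)) =
    Orb-trans x→y (1 , trans (cong (σ G (fsuc c) ⟨$⟩ˡ_) e) (inverseˡ (σ G (fsuc c))))

  sameCycle⇒orbit : ∀ {x y} → SameCycle G c x y → Orb x y
  sameCycle⇒orbit path = fold (λ u w → ∀ {x} → OnCycleOf x u → OnCycleOf x w)
                              (λ s rest on → rest (OnCycleOf-step on s)) (λ on → on) path (0 , refl)

module Flip {d : ℕ} (G : ColoredGraph d) {v₁ v₂ : Fin (n G)} (v₁≢v₂ : v₁ ≢ v₂) where

  G' : ColoredGraph d
  G' = flipG G v₁ v₂

  open Swap v₁≢v₂

  -- τ for G' is τ for G composed with (v₁ v₂), so for every colour the flip either
  -- splits the cycle through v₁ and v₂ or joins their two cycles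
  toggles : ∀ c → (SameCycle G c v₁ v₂ × ¬ SameCycle G' c v₁ v₂) ⊎
                  (¬ SameCycle G c v₁ v₂ × SameCycle G' c v₁ v₂)
  toggles c =
    map-⊎ (λ (o , ¬o') → C.orbit⇒sameCycle o , ¬o' ∘ C'.sameCycle⇒orbit)
          (λ (¬o , o') → ¬o ∘ C.sameCycle⇒orbit , C'.orbit⇒sameCycle o')
          (Transposition.splitsOrJoins C.τ C.τ-injective v₁≢v₂)
    where
    module C  = Cycles G c
    module C' = Cycles G' c

  sameCycle? : ∀ c → Dec (SameCycle G c v₁ v₂)
  sameCycle? c = [ yes ∘ proj₁ , no ∘ proj₁ ] (toggles c)

  module Edges (c : Fin d) where

    S : Fin (suc d) → Set
    S = Bic c

    x y b₁ b₂ : Vertex G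
    x  = inj₁ v₁
    y  = inj₁ v₂
    b₁ = inj₂ (nb G fzero v₁)
    b₂ = inj₂ (nb G fzero v₂)

    oldEdge : ∀ a i → S a → let e = inj₂ (nb G a i) in
              Step G' S (inj₁ i) e ⊎ Joins x b₁ (inj₁ i) e ⊎ Joins y b₂ (inj₁ i) e
    oldEdge (fsuc a) i s = inj₁ (wb (fsuc a) i s)
    oldEdge fzero    i s with swap-cases i
    ... | inj₁ (refl , _)        = inj₂ (inj₁ (inj₁ (refl , refl)))
    ... | inj₂ (inj₁ (refl , _)) = inj₂ (inj₂ (inj₁ (refl , refl)))
    ... | inj₂ (inj₂ fixed)      =
      inj₁ (subst (λ j → Step G' S (inj₁ i) (inj₂ (nb G fzero j))) fixed (wb fzero i s))

    newEdge : ∀ a i → S a → let e = inj₂ (nb G' a i) in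
              Step G S (inj₁ i) e ⊎ Joins x b₂ (inj₁ i) e ⊎ Joins y b₁ (inj₁ i) e
    newEdge (fsuc a) i s = inj₁ (wb (fsuc a) i s)
    newEdge fzero    i s with swap-cases i
    ... | inj₁ (refl , e)        = inj₂ (inj₁ (inj₁ (refl , cong (inj₂ ∘ nb G fzero) e)))
    ... | inj₂ (inj₁ (refl , e)) = inj₂ (inj₂ (inj₁ (refl , cong (inj₂ ∘ nb G fzero) e)))
    ... | inj₂ (inj₂ fixed)      =
      inj₁ (subst (λ j → Step G S (inj₁ i) (inj₂ (nb G fzero j))) (sym fixed) (wb fzero i s))

    classifyOld : ∀ {w z} → Step G S w z → Step G' S w z ⊎ Joins x b₁ w z ⊎ Joins y b₂ w z
    classifyOld (wb a i s) = oldEdge a i s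
    classifyOld (bw a i s) = map-⊎ Step-reverse (map-⊎ Joins-reverse Joins-reverse) (oldEdge a i s)

    classifyNew : ∀ {w z} → Step G' S w z → Step G S w z ⊎ Joins x b₂ w z ⊎ Joins y b₁ w z
    classifyNew (wb a i s) = newEdge a i s
    classifyNew (bw a i s) = map-⊎ Step-reverse (map-⊎ Joins-reverse Joins-reverse) (newEdge a i s)

    xb₁ : Step G S x b₁
    xb₁ = wb fzero v₁ (inj₁ refl)

    yb₂ : Step G S y b₂
    yb₂ = wb fzero v₂ (inj₁ refl)

    xb₂′ : Step G' S x b₂
    xb₂′ = subst (λ j → Step G' S x (inj₂ (nb G fzero j))) swap-a (wb fzero v₁ (inj₁ refl))

    yb₁′ : Step G' S y b₁
    yb₁′ = subst (λ j → Step G' S y (inj₂ (nb G fzero j))) swap-b (wb fzero v₂ (inj₁ refl))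

    countChange : ∀ {k k'} → NumComponents G S k → NumComponents G' S k' →
                  (SameCycle G c v₁ v₂ × k' ≡ suc k) ⊎ (¬ SameCycle G c v₁ v₂ × k ≡ suc k')
    countChange L L' with toggles c
    ... | inj₁ (same , ¬same') =
      inj₁ (same , splitCount classifyOld classifyNew xb₁ yb₂ xb₂′ yb₁′ same ¬same' L L')
    ... | inj₂ (¬same , same') =
      inj₂ (¬same , splitCount classifyNew classifyOld xb₂′ yb₁′ xb₁ yb₂ same' ¬same L' L)

gainOne : ∀ {a a' s s' d i} → a' ≡ suc a → s' + d ≡ s + 2 * i →
          (a' + s') + suc d ≡ (a + s) + 2 * suc i
gainOne {a} {s = s} {s'} {d} {i} refl e = begin
  suc a + s' + suc d   ≡⟨ regroup a s' d ⟩
  2 + a + (s' + d)     ≡⟨ cong (λ t → 2 + a + t) e ⟩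
  2 + a + (s + 2 * i)  ≡⟨ regroup′ a s i ⟩
  a + s + 2 * suc i    ∎
  where
  open ≡-Reasoning
  regroup : ∀ a s' d → suc a + s' + suc d ≡ 2 + a + (s' + d)
  regroup = solve-∀
  regroup′ : ∀ a s i → 2 + a + (s + 2 * i) ≡ a + s + 2 * suc i
  regroup′ = solve-∀

loseOne : ∀ {a a' s s' d i} → a ≡ suc a' → s' + d ≡ s + 2 * i →
          (a' + s') + suc d ≡ (a + s) + 2 * i
loseOne {a' = a'} {s} {s'} {d} {i} refl e = begin
  a' + s' + suc d      ≡⟨ regroup a' s' d ⟩
  suc a' + (s' + d)    ≡⟨ cong (suc a' +_) e ⟩
  suc a' + (s + 2 * i) ≡⟨ sym (+-assoc (suc a') s (2 * i)) ⟩
  suc a' + s + 2 * i   ∎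
  where
  open ≡-Reasoning
  regroup : ∀ a' s' d → a' + s' + suc d ≡ suc a' + (s' + d)
  regroup = solve-∀

CountChange : ∀ {d} → Subset d → (k k' : Fin d → ℕ) → Set
CountChange I k k' = ∀ c → (c ∈ I × k' c ≡ suc (k c)) ⊎ (c ∉ I × k c ≡ suc (k' c))

CountChange-tail : ∀ {d s} {I : Subset d} {k k' : Fin (suc d) → ℕ} →
                   CountChange (s ∷ I) k k' → CountChange I (k ∘ fsuc) (k' ∘ fsuc)
CountChange-tail change c =
  map-⊎ (λ { (there m , e) → m , e }) (λ (∉ , e) → ∉ ∘ there , e) (change (fsuc c))

sumChange : ∀ d (I : Subset d) (k k' : Fin d → ℕ) → CountChange I k k' →
            sum (tabulate k') + d ≡ sum (tabulate k) + 2 * ∣ I ∣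
sumChange zero    []      k k' change = refl
sumChange (suc d) (s ∷ I) k k' change with change fzero
... | inj₁ (here , gain) =
  gainOne {i = ∣ I ∣} gain (sumChange d I (k ∘ fsuc) (k' ∘ fsuc) (CountChange-tail change))
... | inj₂ (0∉ , loss) = lose s 0∉
  where
  lose : ∀ s → fzero ∉ s ∷ I → sum (tabulate k') + suc d ≡ sum (tabulate k) + 2 * ∣ s ∷ I ∣
  lose inside  0∉ = ⊥-elim (0∉ here)
  lose outside _  =
    loseOne {i = ∣ I ∣} loss (sumChange d I (k ∘ fsuc) (k' ∘ fsuc) (CountChange-tail change))

flipFormula : ∀ {d} (G : ColoredGraph d) {v₁ v₂ : Fin (n G)} → v₁ ≢ v₂ → (I : Subset d) →
  (∀ c → (c ∈ I → SameCycle G c v₁ v₂) × (SameCycle G c v₁ v₂ → c ∈ I)) →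
  ∀ {m m'} → C₀ G m → C₀ (flipG G v₁ v₂) m' → m' + d ≡ m + 2 * ∣ I ∣
flipFormula {d} G v₁≢v₂ I I-spec (k , L , refl) (k' , L' , refl) = sumChange d I k k' change
  where
  change : CountChange I k k'
  change c = map-⊎ (λ (same , e) → proj₂ (I-spec c) same , e)
                   (λ (¬same , e) → ¬same ∘ proj₁ (I-spec c) , e)
                   (Flip.Edges.countChange G v₁≢v₂ c (L c) (L' c))

select : ∀ {d} {P : Fin d → Set} → (∀ c → Dec (P c)) → Subset d
select {zero}  P? = []
select {suc d} P? = (if does (P? fzero) then inside else outside) ∷ select (P? ∘ fsuc)

select-spec : ∀ {d} {P : Fin d → Set} (P? : ∀ c → Dec (P c)) →
              ∀ c → (c ∈ select P? → P c) × (P c → c ∈ select P?)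
select-spec P? fzero with P? fzero
... | yes p = (λ _ → p) , (λ _ → here)
... | no ¬p = (λ ()) , (⊥-elim ∘ ¬p)
select-spec P? (fsuc c) =
  (λ { (there m) → proj₁ (select-spec (P? ∘ fsuc) c) m }) ,
  there ∘ proj₂ (select-spec (P? ∘ fsuc) c)

member⇒1≤∣∣ : ∀ {d} {c : Fin d} {I : Subset d} → c ∈ I → 1 ≤ ∣ I ∣
member⇒1≤∣∣ {c = c} {I} c∈I =
  subst (_≤ ∣ I ∣) (∣⁅x⁆∣≡1 c) (p⊆q⇒∣p∣≤∣q∣ (λ m → subst (_∈ I) (sym (x∈⁅y⁆⇒x≡y c m)) c∈I))

members⇒2≤∣∣ : ∀ {d} {c c' : Fin d} {I : Subset d} → c ∈ I → c' ∈ I → c ≢ c' → 2 ≤ ∣ I ∣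
members⇒2≤∣∣ c∈I c'∈I c≢c' =
  ≤-trans (s≤s (member⇒1≤∣∣ (x∈p∧x≢y⇒x∈p-y c'∈I (c≢c' ∘ sym)))) (x∈p⇒∣p-x∣<∣p∣ c∈I)

joiningEdge : ∀ {d} (G : ColoredGraph d) {u w : Fin (n G)} → u ≢ w → ∀ a →
              nb G a u ≡ nb G fzero w → ∃ λ c₀ → a ≡ fsuc c₀ × SameCycle G c₀ u w
joiningEdge G u≢w fzero e = ⊥-elim (u≢w (perm-injective (σ G fzero) e))
joiningEdge G {u} {w} u≢w (fsuc c₀) e =
  c₀ , refl , wb (fsuc c₀) u (inj₂ refl)
            ◅ subst (λ β → Step G (Bic c₀) (inj₂ β) (inj₁ w)) (sym e) (bw fzero w (inj₁ refl))
            ◅ ε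

JoiningEdge : ∀ {d} (G : ColoredGraph d) → Fin (n G) → Fin (n G) → Fin (suc d) → Set
JoiningEdge G v₁ v₂ a = nb G a v₁ ≡ nb G fzero v₂ ⊎ nb G a v₂ ≡ nb G fzero v₁

joiningColour : ∀ {d} (G : ColoredGraph d) {v₁ v₂ : Fin (n G)} → v₁ ≢ v₂ → ∀ {a} →
                JoiningEdge G v₁ v₂ a → ∃ λ c₀ → a ≡ fsuc c₀ × SameCycle G c₀ v₁ v₂
joiningColour G v₁≢v₂ {a} (inj₁ e) = joiningEdge G v₁≢v₂ a e
joiningColour G v₁≢v₂ {a} (inj₂ e) =
  map₂ (map₂ SameCycle-sym) (joiningEdge G (v₁≢v₂ ∘ sym) a e)

module LowerBound {d : ℕ} (G : ColoredGraph d) {v₁ v₂ : Fin (n G)} (v₁≢v₂ : v₁ ≢ v₂) where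

  I : Subset d
  I = select (Flip.sameCycle? G v₁≢v₂)

  I-spec : ∀ c → (c ∈ I → SameCycle G c v₁ v₂) × (SameCycle G c v₁ v₂ → c ∈ I)
  I-spec = select-spec (Flip.sameCycle? G v₁≢v₂)

  sameCycle⇒∈I : ∀ {c} → SameCycle G c v₁ v₂ → c ∈ I
  sameCycle⇒∈I {c} = proj₂ (I-spec c)

  lowerBound : ∀ {m m'} → C₀ G m → C₀ (flipG G v₁ v₂) m' →
               ∀ {j} → j ≤ ∣ I ∣ → m + 2 * j ≤ m' + d
  lowerBound {m} C C' {j} j≤∣I∣ =
    subst (m + 2 * j ≤_) (sym (flipFormula G v₁≢v₂ I I-spec C C')) (+-monoʳ-≤ m (*-monoʳ-≤ 2 j≤∣I∣))

  oneJoiningEdge : ∀ {a} → JoiningEdge G v₁ v₂ a → 1 ≤ ∣ I ∣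
  oneJoiningEdge e = member⇒1≤∣∣ (sameCycle⇒∈I (proj₂ (proj₂ (joiningColour G v₁≢v₂ e))))

  twoJoiningEdges : ∀ {a a'} → a ≢ a' →
                    JoiningEdge G v₁ v₂ a → JoiningEdge G v₁ v₂ a' → 2 ≤ ∣ I ∣
  twoJoiningEdges a≢a' e e' with joiningColour G v₁≢v₂ e | joiningColour G v₁≢v₂ e'
  ... | _ , refl , same | _ , refl , same' =
    members⇒2≤∣∣ (sameCycle⇒∈I same) (sameCycle⇒∈I same') (a≢a' ∘ cong fsuc)

joinedOnceBound : ∀ (G : ColoredGraph 3) {v₁ v₂ : Fin (n G)} → v₁ ≢ v₂ →
  JoinedOnce G v₁ (nb G fzero v₂) ⊎ JoinedOnce G v₂ (nb G fzero v₁) →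
  ∀ {m m'} → C₀ G m → C₀ (flipG G v₁ v₂) m' → m ≤ m' + 1
joinedOnceBound G v₁≢v₂ joined {m} {m'} C C' =
  +-cancelʳ-≤ 2 m (m' + 1)
    (subst (m + 2 ≤_) (sym (+-assoc m' 1 2)) (lowerBound C C' oneColour))
  where
  open LowerBound G v₁≢v₂
  oneColour : 1 ≤ ∣ I ∣
  oneColour = [ (λ (_ , e , _) → oneJoiningEdge (inj₁ e))
              , (λ (_ , e , _) → oneJoiningEdge (inj₂ e)) ]′ joined

joinedTwiceBound : ∀ (G : ColoredGraph 3) {v₁ v₂ : Fin (n G)} → v₁ ≢ v₂ →
  JoinedTwice G v₁ (nb G fzero v₂) ⊎ JoinedTwice G v₂ (nb G fzero v₁) →
  ∀ {m m'} → C₀ G m → C₀ (flipG G v₁ v₂) m' → m + 1 ≤ m'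
joinedTwiceBound G v₁≢v₂ joined {m} {m'} C C' =
  +-cancelʳ-≤ 3 (m + 1) m'
    (subst (_≤ m' + 3) (sym (+-assoc m 1 3)) (lowerBound C C' twoColours))
  where
  open LowerBound G v₁≢v₂
  twoColours : 2 ≤ ∣ I ∣
  twoColours = [ (λ (_ , _ , a≢a' , e , e' , _) → twoJoiningEdges a≢a' (inj₁ e) (inj₁ e'))
               , (λ (_ , _ , a≢a' , e , e' , _) → twoJoiningEdges a≢a' (inj₂ e) (inj₂ e')) ]′ joined

lemma1 : (∀ (d : ℕ) (G : ColoredGraph d) (v₁ v₂ : Fin (n G)) → Connected G → v₁ ≢ v₂ →
    Connected (flipG G v₁ v₂) →
    (I : Subset d) → (∀ c → (c ∈ I → SameCycle G c v₁ v₂) × (SameCycle G c v₁ v₂ → c ∈ I)) →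
    (m m' : ℕ) → C₀ G m → C₀ (flipG G v₁ v₂) m' →
    m' + d ≡ m + 2 * ∣ I ∣)
    ×
    (∀ (G : ColoredGraph 3) (v₁ v₂ : Fin (n G)) → Connected G → v₁ ≢ v₂ →
    Connected (flipG G v₁ v₂) →
    (JoinedOnce G v₁ (nb G Fin.zero v₂) ⊎ JoinedOnce G v₂ (nb G Fin.zero v₁)) →
    (m m' : ℕ) → C₀ G m → C₀ (flipG G v₁ v₂) m' →
    m ≤ m' + 1)
    ×
    (∀ (G : ColoredGraph 3) (v₁ v₂ : Fin (n G)) → Connected G → v₁ ≢ v₂ →
    Connected (flipG G v₁ v₂) →
    (JoinedTwice G v₁ (nb G Fin.zero v₂) ⊎ JoinedTwice G v₂ (nb G Fin.zero v₁)) →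
    (m m' : ℕ) → C₀ G m → C₀ (flipG G v₁ v₂) m' →
    m + 1 ≤ m')
lemma1 =
  (λ d G v₁ v₂ _ v₁≢v₂ _ I I-spec m m' → flipFormula G v₁≢v₂ I I-spec) ,
  (λ G v₁ v₂ _ v₁≢v₂ _ joined m m' → joinedOnceBound G v₁≢v₂ joined) ,
  (λ G v₁ v₂ _ v₁≢v₂ _ joined m m' → joinedTwiceBound G v₁≢v₂ joined)
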